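{- Let $n\ge 4$ and let $\tilde{D}_n$ be the extended Dynkin graph on the $n+1$ vertices $1,2,\ldots,n+1$, with edge set $\{1,3\},\{2,3\},\{n-1,n\},\{n-1,n+1\}$ and $\{i,i+1\}$ for $3\le i\le n-2$. Let $A$ be its adjacency matrix and let $W(\tilde{D}_n)=\begin{bmatrix} e_{n+1} & Ae_{n+1} & \cdots & A^{n}e_{n+1}\end{bmatrix}$ be its walk matrix, where $e_{n+1}$ is the all-ones vector of length $n+1$. Then $\operatorname{rank}W(\tilde{D}_n)=\lfloor n/2\rfloor$.
   Context: $\tilde{D}_n$ is obtained from the path on $n-1$ vertices by attaching a pendant edge at the second vertex (giving the Dynkin graph $D_n$) and then attaching a pendant edge at the second-to-last vertex of $D_n$. For $n=4$ it is the star $K_{1,4}$. -}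

module Defs where

open import Data.Nat using (ℕ; zero; suc; _+_; _*_; _∸_; _≤_; _<_; _≡ᵇ_; _≤ᵇ_)
open import Data.Bool using (Bool; true; false; _∧_; _∨_; if_then_else_)
open import Data.Fin using (Fin; toℕ; zero; suc)
open import Data.Integer using (+_)
open import Data.Rational using (ℚ; 0ℚ; _/_) renaming (_+_ to _+ℚ_; _*_ to _*ℚ_)
open import Data.Product using (Σ; _×_)
open import Function.Definitions using (Injective)
open import Relation.Binary.PropositionalEquality using (_≡_)
open import Relation.Nullary using (¬_)

sumℕ : ∀ {k} → (Fin k → ℕ) → ℕ
sumℕ {zero}  f = 0
sumℕ {suc k} f = f zero + sumℕ (λ i → f (suc i))

sumℚ : ∀ {k} → (Fin k → ℚ) → ℚ
sumℚ {zero}  f = 0ℚ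
sumℚ {suc k} f = f zero +ℚ sumℚ (λ i → f (suc i))

edgeOrd : ℕ → ℕ → ℕ → Bool
edgeOrd n a b =
     ((a ≡ᵇ 1) ∧ (b ≡ᵇ 3))
  ∨ ((a ≡ᵇ 2) ∧ (b ≡ᵇ 3))
  ∨ ((a ≡ᵇ (n ∸ 1)) ∧ (b ≡ᵇ n))
  ∨ ((a ≡ᵇ (n ∸ 1)) ∧ (b ≡ᵇ suc n))
  ∨ ((3 ≤ᵇ a) ∧ (a ≤ᵇ (n ∸ 2)) ∧ (b ≡ᵇ suc a))

edge : ℕ → ℕ → ℕ → Bool
edge n a b = edgeOrd n a b ∨ edgeOrd n b a

-- Adjacency matrix of D̃_n; vertex i : Fin (n+1) stands for label toℕ i + 1.
adjD̃ : (n : ℕ) → Fin (suc n) → Fin (suc n) → ℕ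
adjD̃ n i j = if edge n (suc (toℕ i)) (suc (toℕ j)) then 1 else 0

powOnes : ∀ {m} → (Fin m → Fin m → ℕ) → ℕ → Fin m → ℕ
powOnes A zero    i = 1
powOnes A (suc k) i = sumℕ (λ j → A i j * powOnes A k j)

walkMatrix : ∀ {m} → (Fin m → Fin m → ℕ) → Fin m → Fin m → ℕ
walkMatrix A i k = powOnes A (toℕ k) i

ℕ→ℚ : ℕ → ℚ
ℕ→ℚ k = (+ k) / 1

LinIndep : ∀ {rows k} → (Fin k → Fin rows → ℚ) → Set
LinIndep {rows} {k} v =
  (c : Fin k → ℚ) → (∀ i → sumℚ (λ j → c j *ℚ v j i) ≡ 0ℚ) → ∀ j → c j ≡ 0ℚ

HasRank : ∀ {rows cols} → (Fin rows → Fin cols → ℚ) → ℕ → Set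
HasRank {rows} {cols} M r =
    Σ (Fin r → Fin cols) (λ s → Injective _≡_ _≡_ s × LinIndep (λ j i → M i (s j)))
  × ((s : Fin (suc r) → Fin cols) → Injective _≡_ _≡_ s → ¬ LinIndep (λ j i → M i (s j)))

module Submission where

-- Write n = m + 4. Reflecting the path of D̃ₙ end to end, with the two leaves at each end
-- swapped along, is a graph automorphism; walk counts are constant on its orbits, whose
-- representatives are one leaf and the first ⌊m/2⌋ + 1 path vertices, so W has at most
-- ⌊n/2⌋ distinct rows. Conversely, the weight w equal to 1 on leaves and 2 on the path
-- satisfies A w = 2 w, hence wᵀ Aᵏ e = 2ᵏ wᵀ e, and a relation Σ cₖ Aᵏ e = 0 among the first
-- ⌊n/2⌋ columns gives Σ cₖ 2ᵏ = 0. At the p-th path vertex (Aᵏ e) equals 2ᵏ for k ≤ p but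
-- exceeds 2ᵏ for k = p + 1, so subtracting leaves a triangular system and every cₖ vanishes.

open import Defs
open import Data.Nat as ℕ using (ℕ; zero; suc; z≤n; s≤s; ⌊_/2⌋; ⌈_/2⌉; _^_; _≡ᵇ_; _≤ᵇ_; _∸_; _≤_)
open import Data.Bool using (Bool; true; false; if_then_else_; T; _∧_; _∨_)
open import Data.Bool.Properties using (T-∧; T-∨; ∨-comm)
open import Data.Sum using (_⊎_; inj₁; inj₂)
open import Function.Bundles using (Equivalence)
open import Data.List using (List; []; _∷_; _++_; map)
open import Data.Nat.ListAction using (sum)
open import Data.Nat.ListAction.Properties using (sum-++)
import Data.List.Properties as List
open import Data.List.Relation.Unary.All using (All; []; _∷_)
open import Data.List.Relation.Unary.All.Properties using (All¬⇒¬Any)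
import Data.List.Relation.Unary.All as All
open import Data.List.Relation.Unary.Any using (here; there)
open import Data.List.Membership.Propositional using (_∈_; _∉_)
open import Data.List.Membership.Propositional.Properties using (∈-++⁺ʳ; ∈-++⁻)
open import Data.List.Relation.Unary.Unique.Propositional using (Unique)
open import Data.List.Relation.Unary.AllPairs using ([]; _∷_)
import Data.Nat.Properties as ℕ
open import Data.Rational as ℚ using (ℚ; mkℚ; 0ℚ; 1ℚ)
import Data.Rational.Properties as ℚ
open import Data.Fin as Fin using (Fin; zero; suc; toℕ; punchIn; punchOut)
import Data.Fin.Properties as Fin
open import Data.Fin.Induction using (>-wellFounded; Acc; acc)
open import Data.Product using (∃; _×_; _,_; proj₁; proj₂)
open import Relation.Binary.PropositionalEquality
open import Relation.Nullary using (¬_; yes; no; contradiction)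
open import Relation.Binary.Definitions using (tri<; tri≈; tri>)
open import Function.Base using (_∘_)
open import Function.Definitions using (Injective)

module RationalLinearAlgebra where

  open import Data.Integer as ℤ using (+_)
  import Data.Integer.Properties as ℤ
  open import Data.Nat.Coprimality using (1-coprimeTo)
  import Data.Nat.Coprimality as Coprimality
  open import Data.Rational using (_+_; _*_; -_; _-_; 1/_)
  open import Data.Rational.Solver using (module +-*-Solver)
  open +-*-Solver

  ℕ→ℚ≡mkℚ : ∀ k → ℕ→ℚ k ≡ mkℚ (+ k) 0 (Coprimality.sym (1-coprimeTo k))
  ℕ→ℚ≡mkℚ k = ℚ.normalize-coprime (Coprimality.sym (1-coprimeTo k))

  ℕ→ℚ-+ : ∀ a b → ℕ→ℚ (a ℕ.+ b) ≡ ℕ→ℚ a + ℕ→ℚ b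
  ℕ→ℚ-+ a b rewrite ℕ→ℚ≡mkℚ a | ℕ→ℚ≡mkℚ b =
    cong (ℚ._/ 1) (trans (ℤ.pos-+ a b) (sym (cong₂ ℤ._+_ (ℤ.*-identityʳ (+ a)) (ℤ.*-identityʳ (+ b)))))

  ℕ→ℚ-* : ∀ a b → ℕ→ℚ (a ℕ.* b) ≡ ℕ→ℚ a * ℕ→ℚ b
  ℕ→ℚ-* a b rewrite ℕ→ℚ≡mkℚ a | ℕ→ℚ≡mkℚ b = cong (ℚ._/ 1) (ℤ.pos-* a b)

  ℕ→ℚ-injective : Injective _≡_ _≡_ ℕ→ℚ
  ℕ→ℚ-injective {a} {b} eq rewrite ℕ→ℚ≡mkℚ a | ℕ→ℚ≡mkℚ b =
    ℤ.+-injective (proj₁ (ℚ.mkℚ-injective eq))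

  ℕ→ℚ-suc≢0 : ∀ k → ℕ→ℚ (suc k) ≢ 0ℚ
  ℕ→ℚ-suc≢0 k eq with () ← ℕ→ℚ-injective {suc k} {0} eq

  ℕ→ℚ-ℕ→ℚ≢0 : ∀ {a b} → a ≢ b → ℕ→ℚ a - ℕ→ℚ b ≢ 0ℚ
  ℕ→ℚ-ℕ→ℚ≢0 {a} {b} a≢b eq = a≢b (ℕ→ℚ-injective (begin
    ℕ→ℚ a                    ≡⟨ solve 2 (λ A B → A := (A :- B) :+ B) refl (ℕ→ℚ a) (ℕ→ℚ b) ⟩
    (ℕ→ℚ a - ℕ→ℚ b) + ℕ→ℚ b  ≡⟨ cong (_+ ℕ→ℚ b) eq ⟩
    0ℚ + ℕ→ℚ b               ≡⟨ ℚ.+-identityˡ (ℕ→ℚ b) ⟩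
    ℕ→ℚ b                    ∎))
    where open ≡-Reasoning

  *-cancelʳ-≡0 : ∀ a d → a * d ≡ 0ℚ → d ≢ 0ℚ → a ≡ 0ℚ
  *-cancelʳ-≡0 a d ad≡0 d≢0 = begin
    a              ≡⟨ solve 1 (λ A → A := A :* con 1ℚ) refl a ⟩
    a * 1ℚ         ≡⟨ cong (a *_) (ℚ.*-inverseʳ d) ⟨
    a * (d * 1/ d) ≡⟨ ℚ.*-assoc a d (1/ d) ⟨
    a * d * 1/ d   ≡⟨ cong (_* 1/ d) ad≡0 ⟩
    0ℚ * 1/ d      ≡⟨ ℚ.*-zeroˡ (1/ d) ⟩
    0ℚ             ∎
    where
    open ≡-Reasoning
    instance
      d-nonZero : ℚ.NonZero d
      d-nonZero = ℚ.≢-nonZero d≢0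

  sumℚ-cong : ∀ {k} {f g : Fin k → ℚ} → (∀ i → f i ≡ g i) → sumℚ f ≡ sumℚ g
  sumℚ-cong {zero}  eq = refl
  sumℚ-cong {suc k} eq = cong₂ _+_ (eq zero) (sumℚ-cong (eq ∘ suc))

  sumℚ-zero : ∀ {k} (f : Fin k → ℚ) → (∀ i → f i ≡ 0ℚ) → sumℚ f ≡ 0ℚ
  sumℚ-zero {zero}  f eq = refl
  sumℚ-zero {suc k} f eq rewrite eq zero | sumℚ-zero (f ∘ suc) (eq ∘ suc) = refl

  sumℚ-ℕ→ℚ : ∀ {k} (f : Fin k → ℕ) → sumℚ (ℕ→ℚ ∘ f) ≡ ℕ→ℚ (sumℕ f)
  sumℚ-ℕ→ℚ {zero}  f = refl
  sumℚ-ℕ→ℚ {suc k} f rewrite sumℚ-ℕ→ℚ (f ∘ suc) = sym (ℕ→ℚ-+ (f zero) (sumℕ (f ∘ suc)))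

  *-distribˡ-sumℚ : ∀ {k} x (f : Fin k → ℚ) → x * sumℚ f ≡ sumℚ (λ i → x * f i)
  *-distribˡ-sumℚ {zero}  x f = ℚ.*-zeroʳ x
  *-distribˡ-sumℚ {suc k} x f rewrite sym (*-distribˡ-sumℚ x (f ∘ suc)) =
    ℚ.*-distribˡ-+ x (f zero) (sumℚ (f ∘ suc))

  *-distribʳ-sumℚ : ∀ {k} x (f : Fin k → ℚ) → sumℚ f * x ≡ sumℚ (λ i → f i * x)
  *-distribʳ-sumℚ x f =
    trans (ℚ.*-comm (sumℚ f) x) (trans (*-distribˡ-sumℚ x f) (sumℚ-cong (λ i → ℚ.*-comm x (f i))))

  sumℚ-+ : ∀ {k} (f g : Fin k → ℚ) → sumℚ (λ i → f i + g i) ≡ sumℚ f + sumℚ g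
  sumℚ-+ {zero}  f g = refl
  sumℚ-+ {suc k} f g rewrite sumℚ-+ (f ∘ suc) (g ∘ suc) =
    solve 4 (λ a b c d → (a :+ b) :+ (c :+ d) := (a :+ c) :+ (b :+ d)) refl
      (f zero) (g zero) (sumℚ (f ∘ suc)) (sumℚ (g ∘ suc))

  sumℚ-- : ∀ {k} (f g : Fin k → ℚ) → sumℚ (λ i → f i - g i) ≡ sumℚ f - sumℚ g
  sumℚ-- {zero}  f g = refl
  sumℚ-- {suc k} f g rewrite sumℚ-- (f ∘ suc) (g ∘ suc) =
    solve 4 (λ a b c d → (a :- b) :+ (c :- d) := (a :+ c) :- (b :+ d)) refl
      (f zero) (g zero) (sumℚ (f ∘ suc)) (sumℚ (g ∘ suc))

  sumℚ-comm : ∀ {a b} (f : Fin a → Fin b → ℚ) →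
              sumℚ (λ i → sumℚ (λ j → f i j)) ≡ sumℚ (λ j → sumℚ (λ i → f i j))
  sumℚ-comm {zero}  {b} f = sym (sumℚ-zero {b} (λ _ → 0ℚ) (λ _ → refl))
  sumℚ-comm {suc a} {b} f rewrite sumℚ-comm (f ∘ suc) = sym (sumℚ-+ (f zero) _)

  sumℚ-single : ∀ {k} (f : Fin k → ℚ) t → (∀ i → i ≢ t → f i ≡ 0ℚ) → sumℚ f ≡ f t
  sumℚ-single {suc k} f zero    others rewrite sumℚ-zero (f ∘ suc) (λ i → others (suc i) λ ()) =
    ℚ.+-identityʳ (f zero)
  sumℚ-single {suc k} f (suc t) others
    rewrite others zero (λ ())
          | sumℚ-single (f ∘ suc) t (λ i i≢t → others (suc i) (i≢t ∘ Fin.suc-injective)) =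
    ℚ.+-identityˡ (f (suc t))

  record LinDep {k r} (v : Fin k → Fin r → ℚ) : Set where
    constructor linDep
    field
      coeff       : Fin k → ℚ
      support     : Fin k
      coeff≢0     : coeff support ≢ 0ℚ
      relation    : ∀ i → sumℚ (λ j → coeff j * v j i) ≡ 0ℚ

  LinDep⇒¬LinIndep : ∀ {k r} (v : Fin k → Fin r → ℚ) → LinDep v → ¬ LinIndep v
  LinDep⇒¬LinIndep _ (linDep c j cⱼ≢0 relation) indep = cⱼ≢0 (indep c relation j)

  -- Gaussian elimination: a pivot of the first vector clears one coordinate of the others.
  overfull⇒LinDep : ∀ {r} (u : Fin (suc r) → Fin r → ℚ) → LinDep u
  overfull⇒LinDep {r} u with Fin.all? (λ i → u zero i ℚ.≟ 0ℚ)
  ... | yes u₀≡0 = linDep c zero (λ ()) relation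
    where
    c : Fin (suc r) → ℚ
    c zero    = 1ℚ
    c (suc _) = 0ℚ
    relation : ∀ i → sumℚ (λ j → c j * u j i) ≡ 0ℚ
    relation i rewrite u₀≡0 i | sumℚ-zero (λ j → 0ℚ * u (suc j) i) (λ j → ℚ.*-zeroˡ (u (suc j) i)) = refl
  ... | no u₀≢0 with Fin.¬∀⟶∃¬ r _ (λ i → u zero i ℚ.≟ 0ℚ) u₀≢0
  overfull⇒LinDep {suc r} u | no _ | p , pivot≢0 = linDep c (suc j₀) dⱼ₀≢0 relation
    where
    instance
      pivot-nonZero : ℚ.NonZero (u zero p)
      pivot-nonZero = ℚ.≢-nonZero pivot≢0

    coef : Fin (suc r) → ℚ
    coef j = u (suc j) p * 1/ u zero p

    eliminated : Fin (suc r) → Fin r → ℚ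
    eliminated j i = u (suc j) (punchIn p i) - coef j * u zero (punchIn p i)

    open LinDep (overfull⇒LinDep eliminated)
      renaming (coeff to d; support to j₀; coeff≢0 to dⱼ₀≢0; relation to d-relation)

    c : Fin (suc (suc r)) → ℚ
    c zero    = - sumℚ (λ j → d j * coef j)
    c (suc j) = d j

    reduced : Fin (suc r) → ℚ
    reduced i = sumℚ (λ j → d j * (u (suc j) i - coef j * u zero i))

    combination≡reduced : ∀ i → sumℚ (λ j → c j * u j i) ≡ reduced i
    combination≡reduced i = sym (begin
      reduced i
        ≡⟨ sumℚ-cong (λ j → solve 4 (λ D U C V → D :* (U :- C :* V) := D :* U :- D :* C :* V) refl
                               (d j) (u (suc j) i) (coef j) (u zero i)) ⟩
      sumℚ (λ j → d j * u (suc j) i - d j * coef j * u zero i)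
        ≡⟨ sumℚ-- (λ j → d j * u (suc j) i) (λ j → d j * coef j * u zero i) ⟩
      sumℚ (λ j → d j * u (suc j) i) - sumℚ (λ j → d j * coef j * u zero i)
        ≡⟨ cong (λ t → sumℚ (λ j → d j * u (suc j) i) - t) (*-distribʳ-sumℚ (u zero i) (λ j → d j * coef j)) ⟨
      sumℚ (λ j → d j * u (suc j) i) - sumℚ (λ j → d j * coef j) * u zero i
        ≡⟨ solve 3 (λ S T V → S :- T :* V := (:- T) :* V :+ S) refl
                   (sumℚ (λ j → d j * u (suc j) i)) (sumℚ (λ j → d j * coef j)) (u zero i) ⟩
      sumℚ (λ j → c j * u j i) ∎)
      where open ≡-Reasoning

    reduced-pivot : reduced p ≡ 0ℚ
    reduced-pivot = sumℚ-zero _ λ j → trans (cong (d j *_) (cleared (u (suc j) p))) (ℚ.*-zeroʳ (d j))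
      where
      cleared : ∀ x → x - x * 1/ u zero p * u zero p ≡ 0ℚ
      cleared x = begin
        x - x * 1/ u zero p * u zero p   ≡⟨ cong (λ t → x - t) (ℚ.*-assoc x (1/ u zero p) (u zero p)) ⟩
        x - x * (1/ u zero p * u zero p) ≡⟨ cong (λ t → x - x * t) (ℚ.*-inverseˡ (u zero p)) ⟩
        x - x * 1ℚ                       ≡⟨ solve 1 (λ X → X :- X :* con 1ℚ := con 0ℚ) refl x ⟩
        0ℚ                               ∎
        where open ≡-Reasoning

    relation : ∀ i → sumℚ (λ j → c j * u j i) ≡ 0ℚ
    relation i with i Fin.≟ p
    ... | yes refl = trans (combination≡reduced p) reduced-pivot
    ... | no i≢p   = begin
      sumℚ (λ j → c j * u j i)         ≡⟨ combination≡reduced i ⟩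
      reduced i                        ≡⟨ cong reduced (Fin.punchIn-punchOut p≢i) ⟨
      reduced (punchIn p (punchOut p≢i)) ≡⟨ d-relation (punchOut p≢i) ⟩
      0ℚ                               ∎
      where
      open ≡-Reasoning
      p≢i : p ≢ i
      p≢i = i≢p ∘ sym

  rowsRepresented⇒¬LinIndep : ∀ {rows cols r} (M : Fin rows → Fin cols → ℚ) (ρ : Fin r → Fin rows) →
                              (∀ i → ∃ λ t → ∀ k → M i k ≡ M (ρ t) k) →
                              (s : Fin (suc r) → Fin cols) → ¬ LinIndep (λ j i → M i (s j))
  rowsRepresented⇒¬LinIndep M ρ represented s =
    LinDep⇒¬LinIndep (λ j i → M i (s j)) (linDep coeff support coeff≢0 relationOnAllRows)
    where
    open LinDep (overfull⇒LinDep (λ j t → M (ρ t) (s j)))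
    relationOnAllRows : ∀ i → sumℚ (λ j → coeff j * M i (s j)) ≡ 0ℚ
    relationOnAllRows i = trans (sumℚ-cong (λ j → cong (coeff j *_) (proj₂ (represented i) (s j))))
                                (relation (proj₁ (represented i)))

  triangular⇒relation-trivial : ∀ {r} (a : Fin r → Fin r → ℚ) →
                                (∀ {t j} → j Fin.< t → a t j ≡ 0ℚ) → (∀ t → a t t ≢ 0ℚ) →
                                (c : Fin r → ℚ) → (∀ t → sumℚ (λ j → c j * a t j) ≡ 0ℚ) →
                                ∀ t → c t ≡ 0ℚ
  triangular⇒relation-trivial a triangular diagonal c relation t = go t (>-wellFounded t)
    where
    go : ∀ t → Acc Fin._>_ t → c t ≡ 0ℚ
    go t (acc later) = *-cancelʳ-≡0 (c t) (a t t) (trans (sym (sumℚ-single _ t offDiagonal)) (relation t)) (diagonal t)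
      where
      offDiagonal : ∀ j → j ≢ t → c j * a t j ≡ 0ℚ
      offDiagonal j j≢t with Fin.<-cmp j t
      ... | tri< j<t _ _ = trans (cong (c j *_) (triangular j<t)) (ℚ.*-zeroʳ (c j))
      ... | tri≈ _ j≡t _ = contradiction j≡t j≢t
      ... | tri> _ _ t<j = trans (cong (_* a t j) (go j (later t<j))) (ℚ.*-zeroˡ (a t j))

  relation⇒functional-relation : ∀ {k rows} (v : Fin k → Fin rows → ℚ) (c : Fin k → ℚ) (w : Fin rows → ℚ) →
                                 (∀ i → sumℚ (λ j → c j * v j i) ≡ 0ℚ) →
                                 sumℚ (λ j → c j * sumℚ (λ i → w i * v j i)) ≡ 0ℚ
  relation⇒functional-relation v c w relation = begin
    sumℚ (λ j → c j * sumℚ (λ i → w i * v j i))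
      ≡⟨ sumℚ-cong (λ j → *-distribˡ-sumℚ (c j) (λ i → w i * v j i)) ⟩
    sumℚ (λ j → sumℚ (λ i → c j * (w i * v j i)))
      ≡⟨ sumℚ-comm (λ j i → c j * (w i * v j i)) ⟩
    sumℚ (λ i → sumℚ (λ j → c j * (w i * v j i)))
      ≡⟨ sumℚ-cong (λ i → sumℚ-cong (λ j → solve 3 (λ C W V → C :* (W :* V) := W :* (C :* V)) refl (c j) (w i) (v j i))) ⟩
    sumℚ (λ i → sumℚ (λ j → w i * (c j * v j i)))
      ≡⟨ sumℚ-cong (λ i → *-distribˡ-sumℚ (w i) (λ j → c j * v j i)) ⟨
    sumℚ (λ i → w i * sumℚ (λ j → c j * v j i))
      ≡⟨ sumℚ-zero _ (λ i → trans (cong (w i *_) (relation i)) (ℚ.*-zeroʳ (w i))) ⟩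
    0ℚ ∎
    where open ≡-Reasoning

  sumℚ-*-distribˡ-- : ∀ {k} (c f g : Fin k → ℚ) →
                      sumℚ (λ j → c j * (f j - g j)) ≡ sumℚ (λ j → c j * f j) - sumℚ (λ j → c j * g j)
  sumℚ-*-distribˡ-- c f g =
    trans (sumℚ-cong (λ j → solve 3 (λ C F G → C :* (F :- G) := C :* F :- C :* G) refl (c j) (f j) (g j)))
          (sumℚ-- (λ j → c j * f j) (λ j → c j * g j))

open RationalLinearAlgebra

≡ᵇ-refl : ∀ a → T (a ≡ᵇ a)
≡ᵇ-refl a = ℕ.≡⇒≡ᵇ a a refl

≡true : ∀ {b} → T b → b ≡ true
≡true {true} _ = refl

≡false : ∀ {b} → ¬ T b → b ≡ false
≡false {false} _  = refl
≡false {true}  ¬t = contradiction _ ¬t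

≡ᵇ-≢ : ∀ {a b} → a ≢ b → (a ≡ᵇ b) ≡ false
≡ᵇ-≢ {a} {b} a≢b = ≡false (a≢b ∘ ℕ.≡ᵇ⇒≡ a b)

≤ᵇ-true : ∀ {p q} → p ≤ q → (p ≤ᵇ q) ≡ true
≤ᵇ-true p≤q = ≡true (ℕ.≤⇒≤ᵇ p≤q)

≤ᵇ-false : ∀ {p q} → ¬ p ≤ q → (p ≤ᵇ q) ≡ false
≤ᵇ-false {p} {q} p≰q = ≡false (p≰q ∘ ℕ.≤ᵇ⇒≤ p q)

T-∨ʳ : ∀ x {y} → T y → T (x ∨ y)
T-∨ʳ true  _  = _
T-∨ʳ false ty = ty

T-∨ˡ : ∀ {x} y → T x → T (x ∨ y)
T-∨ˡ {true} _ _ = _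

≡ᵇ-pair : ∀ a b x y → T ((a ≡ᵇ x) ∧ (b ≡ᵇ y)) → a ≡ x × b ≡ y
≡ᵇ-pair a b x y t with Equivalence.to T-∧ t
... | tx , ty = ℕ.≡ᵇ⇒≡ a x tx , ℕ.≡ᵇ⇒≡ b y ty

indicator : Bool → ℕ
indicator b = if b then 1 else 0

data OrderedEdge (n : ℕ) : ℕ → ℕ → Set where
  edge-1-3     : OrderedEdge n 1 3
  edge-2-3     : OrderedEdge n 2 3
  edge-n₋₁-n   : OrderedEdge n (n ∸ 1) n
  edge-n₋₁-n₊₁ : OrderedEdge n (n ∸ 1) (suc n)
  edge-path    : ∀ a → 3 ≤ a → a ≤ n ∸ 2 → OrderedEdge n a (suc a)

edgeOrd⇒OrderedEdge : ∀ n a b → T (edgeOrd n a b) → OrderedEdge n a b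
edgeOrd⇒OrderedEdge n a b t with Equivalence.to T-∨ t
... | inj₁ t₁ with ≡ᵇ-pair a b 1 3 t₁
...   | refl , refl = edge-1-3
edgeOrd⇒OrderedEdge n a b _ | inj₂ t with Equivalence.to T-∨ t
... | inj₁ t₂ with ≡ᵇ-pair a b 2 3 t₂
...   | refl , refl = edge-2-3
edgeOrd⇒OrderedEdge n a b _ | inj₂ _ | inj₂ t with Equivalence.to T-∨ t
... | inj₁ t₃ with ≡ᵇ-pair a b (n ∸ 1) n t₃
...   | refl , refl = edge-n₋₁-n
edgeOrd⇒OrderedEdge n a b _ | inj₂ _ | inj₂ _ | inj₂ t with Equivalence.to T-∨ t
... | inj₁ t₄ with ≡ᵇ-pair a b (n ∸ 1) (suc n) t₄
...   | refl , refl = edge-n₋₁-n₊₁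
edgeOrd⇒OrderedEdge n a b _ | inj₂ _ | inj₂ _ | inj₂ _ | inj₂ t₅ with Equivalence.to (T-∧ {3 ≤ᵇ a}) t₅
...   | 3≤a , t₆ with Equivalence.to (T-∧ {a ≤ᵇ n ∸ 2}) t₆
...     | a≤n-2 , b≡1+a with ℕ.≡ᵇ⇒≡ b (suc a) b≡1+a
...       | refl = edge-path a (ℕ.≤ᵇ⇒≤ 3 a 3≤a) (ℕ.≤ᵇ⇒≤ a (n ∸ 2) a≤n-2)

OrderedEdge⇒edgeOrd : ∀ {n a b} → OrderedEdge n a b → T (edgeOrd n a b)
OrderedEdge⇒edgeOrd edge-1-3 = _
OrderedEdge⇒edgeOrd edge-2-3 = _
OrderedEdge⇒edgeOrd {n} edge-n₋₁-n =
  T-∨ʳ ((n ∸ 1 ≡ᵇ 1) ∧ (n ≡ᵇ 3)) (T-∨ʳ ((n ∸ 1 ≡ᵇ 2) ∧ (n ≡ᵇ 3))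
    (T-∨ˡ _ (Equivalence.from T-∧ (≡ᵇ-refl (n ∸ 1) , ≡ᵇ-refl n))))
OrderedEdge⇒edgeOrd {n} edge-n₋₁-n₊₁ =
  T-∨ʳ ((n ∸ 1 ≡ᵇ 1) ∧ (suc n ≡ᵇ 3)) (T-∨ʳ ((n ∸ 1 ≡ᵇ 2) ∧ (suc n ≡ᵇ 3))
    (T-∨ʳ ((n ∸ 1 ≡ᵇ n ∸ 1) ∧ (suc n ≡ᵇ n))
      (T-∨ˡ _ (Equivalence.from T-∧ (≡ᵇ-refl (n ∸ 1) , ≡ᵇ-refl (suc n))))))
OrderedEdge⇒edgeOrd {n} (edge-path a 3≤a a≤n∸2) =
  T-∨ʳ ((a ≡ᵇ 1) ∧ (suc a ≡ᵇ 3)) (T-∨ʳ ((a ≡ᵇ 2) ∧ (suc a ≡ᵇ 3))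
    (T-∨ʳ ((a ≡ᵇ n ∸ 1) ∧ (suc a ≡ᵇ n)) (T-∨ʳ ((a ≡ᵇ n ∸ 1) ∧ (suc a ≡ᵇ suc n))
      (Equivalence.from T-∧ (ℕ.≤⇒≤ᵇ 3≤a , Equivalence.from T-∧ (ℕ.≤⇒≤ᵇ a≤n∸2 , ≡ᵇ-refl (suc a)))))))

Edge : ℕ → ℕ → ℕ → Set
Edge n a b = OrderedEdge n a b ⊎ OrderedEdge n b a

edge⇒Edge : ∀ n a b → T (edge n a b) → Edge n a b
edge⇒Edge n a b t with Equivalence.to T-∨ t
... | inj₁ ab = inj₁ (edgeOrd⇒OrderedEdge n a b ab)
... | inj₂ ba = inj₂ (edgeOrd⇒OrderedEdge n b a ba)

Edge⇒edge : ∀ {n a b} → Edge n a b → T (edge n a b)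
Edge⇒edge {n} {a} {b} (inj₁ ab) = T-∨ˡ (edgeOrd n b a) (OrderedEdge⇒edgeOrd ab)
Edge⇒edge {n} {a} {b} (inj₂ ba) = T-∨ʳ (edgeOrd n a b) (OrderedEdge⇒edgeOrd ba)

adjD̃-symmetric : ∀ n i j → adjD̃ n i j ≡ adjD̃ n j i
adjD̃-symmetric n i j = cong indicator (∨-comm (edgeOrd n (suc (toℕ i)) (suc (toℕ j))) (edgeOrd n (suc (toℕ j)) (suc (toℕ i))))

module NaturalSums where

  open import Data.Nat using (_+_; _*_)
  open import Data.Nat.Solver using (module +-*-Solver)
  open +-*-Solver using (solve; _:+_; _:*_; _:=_)
  open import Algebra.Properties.CommutativeSemigroup ℕ.+-commutativeSemigroup using (interchange)

  sumℕ-cong : ∀ {k} {f g : Fin k → ℕ} → (∀ i → f i ≡ g i) → sumℕ f ≡ sumℕ g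
  sumℕ-cong {zero}  eq = refl
  sumℕ-cong {suc k} eq = cong₂ _+_ (eq zero) (sumℕ-cong (eq ∘ suc))

  sumℕ-zero : ∀ {k} (f : Fin k → ℕ) → (∀ i → f i ≡ 0) → sumℕ f ≡ 0
  sumℕ-zero {zero}  f eq = refl
  sumℕ-zero {suc k} f eq rewrite eq zero = sumℕ-zero (f ∘ suc) (eq ∘ suc)

  sumℕ-+ : ∀ {k} (f g : Fin k → ℕ) → sumℕ (λ i → f i + g i) ≡ sumℕ f + sumℕ g
  sumℕ-+ {zero}  f g = refl
  sumℕ-+ {suc k} f g rewrite sumℕ-+ (f ∘ suc) (g ∘ suc) =
    interchange (f zero) (g zero) (sumℕ (f ∘ suc)) (sumℕ (g ∘ suc))

  *-distribˡ-sumℕ : ∀ {k} x (f : Fin k → ℕ) → x * sumℕ f ≡ sumℕ (λ i → x * f i)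
  *-distribˡ-sumℕ {zero}  x f = ℕ.*-zeroʳ x
  *-distribˡ-sumℕ {suc k} x f rewrite sym (*-distribˡ-sumℕ x (f ∘ suc)) =
    ℕ.*-distribˡ-+ x (f zero) (sumℕ (f ∘ suc))

  sumℕ-comm : ∀ {a b} (f : Fin a → Fin b → ℕ) →
              sumℕ (λ i → sumℕ (λ j → f i j)) ≡ sumℕ (λ j → sumℕ (λ i → f i j))
  sumℕ-comm {zero}  {b} f = sym (sumℕ-zero {b} (λ _ → 0) (λ _ → refl))
  sumℕ-comm {suc a} {b} f rewrite sumℕ-comm (f ∘ suc) = sym (sumℕ-+ (f zero) _)

  powOnes-eigenweight : ∀ {N} (A : Fin N → Fin N → ℕ) (u : Fin N → ℕ) (μ : ℕ) →
                        (∀ i j → A i j ≡ A j i) → (∀ i → sumℕ (λ j → A i j * u j) ≡ μ * u i) →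
                        ∀ k → sumℕ (λ i → u i * powOnes A k i) ≡ μ ^ k * sumℕ u
  powOnes-eigenweight A u μ symmetric eigen zero =
    trans (sumℕ-cong (λ i → ℕ.*-identityʳ (u i))) (sym (ℕ.*-identityˡ (sumℕ u)))
  powOnes-eigenweight {N} A u μ symmetric eigen (suc k) = begin
    sumℕ (λ i → u i * sumℕ (λ j → A i j * w j))
      ≡⟨ sumℕ-cong (λ i → *-distribˡ-sumℕ (u i) (λ j → A i j * w j)) ⟩
    sumℕ (λ i → sumℕ (λ j → u i * (A i j * w j)))
      ≡⟨ sumℕ-comm (λ i j → u i * (A i j * w j)) ⟩
    sumℕ (λ j → sumℕ (λ i → u i * (A i j * w j)))
      ≡⟨ sumℕ-cong (λ j → sumℕ-cong (λ i → transpose i j)) ⟩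
    sumℕ (λ j → sumℕ (λ i → w j * (A j i * u i)))
      ≡⟨ sumℕ-cong (λ j → *-distribˡ-sumℕ (w j) (λ i → A j i * u i)) ⟨
    sumℕ (λ j → w j * sumℕ (λ i → A j i * u i))
      ≡⟨ sumℕ-cong (λ j → cong (w j *_) (eigen j)) ⟩
    sumℕ (λ j → w j * (μ * u j))
      ≡⟨ sumℕ-cong (λ j → solve 3 (λ W L U → W :* (L :* U) := L :* (U :* W)) refl (w j) μ (u j)) ⟩
    sumℕ (λ j → μ * (u j * w j))
      ≡⟨ *-distribˡ-sumℕ μ (λ j → u j * w j) ⟨
    μ * sumℕ (λ j → u j * w j)
      ≡⟨ cong (μ *_) (powOnes-eigenweight A u μ symmetric eigen k) ⟩
    μ * (μ ^ k * sumℕ u)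
      ≡⟨ ℕ.*-assoc μ (μ ^ k) (sumℕ u) ⟨
    μ ^ suc k * sumℕ u ∎
    where
    open ≡-Reasoning
    w : Fin N → ℕ
    w = powOnes A k
    transpose : ∀ i j → u i * (A i j * w j) ≡ w j * (A j i * u i)
    transpose i j rewrite symmetric i j =
      solve 3 (λ U E W → U :* (E :* W) := W :* (E :* U)) refl (u i) (A j i) (w j)

  occurrences : ℕ → List ℕ → ℕ
  occurrences y []      = 0
  occurrences y (t ∷ L) = indicator (y ≡ᵇ t) + occurrences y L

  occurrences-∉ : ∀ {y} L → y ∉ L → occurrences y L ≡ 0
  occurrences-∉ []      _   = refl
  occurrences-∉ (t ∷ L) y∉L rewrite ≡ᵇ-≢ (y∉L ∘ here) = occurrences-∉ L (y∉L ∘ there)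

  occurrences-∈ : ∀ {y} L → Unique L → y ∈ L → occurrences y L ≡ 1
  occurrences-∈ {y} (y ∷ L) (y∉L ∷ _) (here refl)
    rewrite ≡true (≡ᵇ-refl y) | occurrences-∉ L (All¬⇒¬Any y∉L) = refl
  occurrences-∈ (t ∷ L) (t∉L ∷ unique) (there y∈L)
    rewrite ≡ᵇ-≢ (λ y≡t → All.lookup t∉L y∈L (sym y≡t)) = occurrences-∈ L unique y∈L

  sumℕ-indicator : ∀ {k} t (g : ℕ → ℕ) → t ℕ.< k →
                   sumℕ {k} (λ j → indicator (toℕ j ≡ᵇ t) * g (toℕ j)) ≡ g t
  sumℕ-indicator {suc k} zero g _
    rewrite sumℕ-zero {k} (λ j → indicator (suc (toℕ j) ≡ᵇ 0) * g (suc (toℕ j))) (λ _ → refl) =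
    trans (ℕ.+-identityʳ _) (ℕ.+-identityʳ (g 0))
  sumℕ-indicator {suc k} (suc t) g (s≤s t<k) = sumℕ-indicator t (g ∘ suc) t<k

  sumℕ-occurrences : ∀ {k} L (g : ℕ → ℕ) → All (ℕ._< k) L →
                     sumℕ {k} (λ j → occurrences (toℕ j) L * g (toℕ j)) ≡ sum (map g L)
  sumℕ-occurrences {k} []      g []          = sumℕ-zero {k} _ (λ _ → refl)
  sumℕ-occurrences {k} (t ∷ L) g (t<k ∷ L<k) = begin
    sumℕ {k} (λ j → (indicator (toℕ j ≡ᵇ t) + occurrences (toℕ j) L) * g (toℕ j))
      ≡⟨ sumℕ-cong {k} (λ j → ℕ.*-distribʳ-+ (g (toℕ j)) (indicator (toℕ j ≡ᵇ t)) _) ⟩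
    sumℕ (λ j → δₜ j + rest j)
      ≡⟨ sumℕ-+ δₜ rest ⟩
    sumℕ δₜ + sumℕ rest
      ≡⟨ cong₂ _+_ (sumℕ-indicator t g t<k) (sumℕ-occurrences L g L<k) ⟩
    g t + sum (map g L) ∎
    where
    open ≡-Reasoning
    δₜ rest : Fin k → ℕ
    δₜ j   = indicator (toℕ j ≡ᵇ t) * g (toℕ j)
    rest j = occurrences (toℕ j) L * g (toℕ j)

  ≤⌊n/2⌋⇒+≤n : ∀ {n a b} → a ≤ ⌊ n /2⌋ → b ≤ ⌊ n /2⌋ → a + b ≤ n
  ≤⌊n/2⌋⇒+≤n {n} {a} {b} a≤ b≤ = begin
    a + b               ≤⟨ ℕ.+-mono-≤ a≤ (ℕ.≤-trans b≤ (ℕ.⌊n/2⌋≤⌈n/2⌉ n)) ⟩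
    ⌊ n /2⌋ + ⌈ n /2⌉   ≡⟨ ℕ.⌊n/2⌋+⌈n/2⌉≡n n ⟩
    n                   ∎
    where open ℕ.≤-Reasoning

  complement≤⌊n/2⌋ : ∀ {n p q} → p + q ≡ n → ⌊ n /2⌋ ℕ.< p → q ≤ ⌊ n /2⌋
  complement≤⌊n/2⌋ {n} {p} {q} p+q≡n ⌊n/2⌋<p = ℕ.+-cancelʳ-≤ ⌈ n /2⌉ q ⌊ n /2⌋ (begin
    q + ⌈ n /2⌉         ≤⟨ ℕ.+-monoʳ-≤ q (ℕ.≤-trans (ℕ.⌈n/2⌉-mono (ℕ.n≤1+n n)) ⌊n/2⌋<p) ⟩
    q + p               ≡⟨ trans (ℕ.+-comm q p) p+q≡n ⟩
    n                   ≡⟨ ℕ.⌊n/2⌋+⌈n/2⌉≡n n ⟨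
    ⌊ n /2⌋ + ⌈ n /2⌉   ∎)
    where open ℕ.≤-Reasoning

  sum-map-++ : ∀ (f : ℕ → ℕ) xs ys → sum (map f (xs ++ ys)) ≡ sum (map f xs) + sum (map f ys)
  sum-map-++ f xs ys rewrite List.map-++ f xs ys = sum-++ (map f xs) (map f ys)

  *-distribˡ-sum-map : ∀ c (f : ℕ → ℕ) xs → c * sum (map f xs) ≡ sum (map (λ x → c * f x) xs)
  *-distribˡ-sum-map c f []       = ℕ.*-zeroʳ c
  *-distribˡ-sum-map c f (x ∷ xs) =
    trans (ℕ.*-distribˡ-+ c (f x) (sum (map f xs))) (cong (c * f x +_) (*-distribˡ-sum-map c f xs))

  sum-map-mono : ∀ {f g : ℕ → ℕ} xs → (∀ {x} → x ∈ xs → f x ≤ g x) → sum (map f xs) ≤ sum (map g xs)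
  sum-map-mono []       f≤g = z≤n
  sum-map-mono (x ∷ xs) f≤g = ℕ.+-mono-≤ (f≤g (here refl)) (sum-map-mono xs (f≤g ∘ there))

open NaturalSums

-- Vertex x of D̃ₙ, n = m + 4, carries the label x + 1: the path runs through 2, …, m + 2,
-- the leaves 0 and 1 hang at 2 and the leaves m + 3 and m + 4 at m + 2.
module D̃ (m : ℕ) where

  open import Data.Nat using (_+_; _*_)
  open import Data.Nat.Solver using (module +-*-Solver)
  open +-*-Solver using (solve; _:+_; _:*_; _:=_; con)

  n : ℕ
  n = 4 + m

  left : ℕ → List ℕ
  left zero    = 0 ∷ 1 ∷ []
  left (suc p) = suc (suc p) ∷ []

  right : ℕ → List ℕ
  right p = if p ≡ᵇ m then 3 + m ∷ 4 + m ∷ [] else 3 + p ∷ []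

  nbrs : ℕ → List ℕ
  nbrs zero          = 2 ∷ []
  nbrs (suc zero)    = 2 ∷ []
  nbrs (suc (suc p)) = if p ≤ᵇ m then left p ++ right p else 2 + m ∷ []

  nbrs-path : ∀ {p} → p ≤ m → nbrs (2 + p) ≡ left p ++ right p
  nbrs-path p≤m rewrite ≤ᵇ-true p≤m = refl

  nbrs-inner : ∀ {p} → p ℕ.< m → nbrs (2 + p) ≡ left p ++ (3 + p ∷ [])
  nbrs-inner p<m rewrite ≤ᵇ-true (ℕ.<⇒≤ p<m) | ≡ᵇ-≢ (ℕ.<⇒≢ p<m) = refl

  nbrs-end : nbrs (2 + m) ≡ left m ++ (3 + m ∷ 4 + m ∷ [])
  nbrs-end rewrite ≤ᵇ-true (ℕ.≤-refl {m}) | ≡true (≡ᵇ-refl m) = refl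

  nbrs-leaf : ∀ {p} → m ℕ.< p → nbrs (2 + p) ≡ 2 + m ∷ []
  nbrs-leaf m<p rewrite ≤ᵇ-false (ℕ.<⇒≱ m<p) = refl

  data Vertex : ℕ → Set where
    leaf₀ : Vertex 0
    leaf₁ : Vertex 1
    inner : ∀ {p} → p ℕ.< m → Vertex (2 + p)
    end   : Vertex (2 + m)
    leaf₂ : Vertex (3 + m)
    leaf₃ : Vertex (4 + m)

  vertex : ∀ {x} → x ≤ n → Vertex x
  vertex {zero}        _ = leaf₀
  vertex {suc zero}    _ = leaf₁
  vertex {suc (suc p)} (s≤s (s≤s p≤2+m)) with p ℕ.≤? m
  ... | yes p≤m with ℕ.m≤n⇒m<n∨m≡n p≤m
  ...   | inj₁ p<m  = inner p<m
  ...   | inj₂ refl = end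
  vertex {suc (suc p)} (s≤s (s≤s p≤2+m)) | no p≰m with ℕ.m≤n⇒m<n∨m≡n p≤2+m
  ...   | inj₂ refl = leaf₃
  ...   | inj₁ (s≤s p≤1+m) with ℕ.m≤n⇒m<n∨m≡n p≤1+m
  ...     | inj₂ refl       = leaf₂
  ...     | inj₁ (s≤s p≤m)  = contradiction p≤m p≰m

  OrderedEdge⇒∈nbrs : ∀ {x y} → OrderedEdge n (suc x) (suc y) → y ∈ nbrs x
  OrderedEdge⇒∈nbrs edge-1-3     = here refl
  OrderedEdge⇒∈nbrs edge-2-3     = here refl
  OrderedEdge⇒∈nbrs edge-n₋₁-n   rewrite nbrs-end = ∈-++⁺ʳ (left m) (here refl)
  OrderedEdge⇒∈nbrs edge-n₋₁-n₊₁ rewrite nbrs-end = ∈-++⁺ʳ (left m) (there (here refl))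
  OrderedEdge⇒∈nbrs {zero}        (edge-path _ (s≤s ()) _)
  OrderedEdge⇒∈nbrs {suc zero}    (edge-path _ (s≤s (s≤s ())) _)
  OrderedEdge⇒∈nbrs {suc (suc p)} (edge-path _ _ (s≤s (s≤s p<m))) rewrite nbrs-inner p<m =
    ∈-++⁺ʳ (left p) (here refl)

  OrderedEdge⇒∈nbrs⁻ : ∀ {x y} → OrderedEdge n (suc y) (suc x) → y ∈ nbrs x
  OrderedEdge⇒∈nbrs⁻ edge-1-3     rewrite nbrs-path {0} z≤n = here refl
  OrderedEdge⇒∈nbrs⁻ edge-2-3     rewrite nbrs-path {0} z≤n = there (here refl)
  OrderedEdge⇒∈nbrs⁻ edge-n₋₁-n   rewrite nbrs-leaf {suc m} ℕ.≤-refl = here refl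
  OrderedEdge⇒∈nbrs⁻ edge-n₋₁-n₊₁ rewrite nbrs-leaf {2 + m} (ℕ.n≤1+n _) = here refl
  OrderedEdge⇒∈nbrs⁻ {y = zero}     (edge-path _ (s≤s ()) _)
  OrderedEdge⇒∈nbrs⁻ {y = suc zero} (edge-path _ (s≤s (s≤s ())) _)
  OrderedEdge⇒∈nbrs⁻ {y = suc (suc q)} (edge-path _ _ (s≤s (s≤s 1+q≤m))) rewrite nbrs-path 1+q≤m =
    here refl

  ∈left⇒Edge : ∀ {p y} → p ≤ m → y ∈ left p → Edge n (3 + p) (suc y)
  ∈left⇒Edge {zero}  _     (here refl)         = inj₂ edge-1-3
  ∈left⇒Edge {zero}  _     (there (here refl)) = inj₂ edge-2-3
  ∈left⇒Edge {suc q} 1+q≤m (here refl)         = inj₂ (edge-path (3 + q) (s≤s (s≤s (s≤s z≤n))) (s≤s (s≤s 1+q≤m)))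

  ∈nbrs⇒Edge : ∀ {x y} → Vertex x → y ∈ nbrs x → Edge n (suc x) (suc y)
  ∈nbrs⇒Edge leaf₀ (here refl) = inj₁ edge-1-3
  ∈nbrs⇒Edge leaf₁ (here refl) = inj₁ edge-2-3
  ∈nbrs⇒Edge (inner {p} p<m) y∈ rewrite nbrs-inner p<m with ∈-++⁻ (left p) y∈
  ... | inj₁ y∈left      = ∈left⇒Edge (ℕ.<⇒≤ p<m) y∈left
  ... | inj₂ (here refl) = inj₁ (edge-path (3 + p) (s≤s (s≤s (s≤s z≤n))) (s≤s (s≤s p<m)))
  ∈nbrs⇒Edge end y∈ rewrite nbrs-end with ∈-++⁻ (left m) y∈
  ... | inj₁ y∈left              = ∈left⇒Edge ℕ.≤-refl y∈left
  ... | inj₂ (here refl)         = inj₁ edge-n₋₁-n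
  ... | inj₂ (there (here refl)) = inj₁ edge-n₋₁-n₊₁
  ∈nbrs⇒Edge leaf₂ y∈ rewrite nbrs-leaf {suc m} ℕ.≤-refl with y∈
  ... | here refl = inj₂ edge-n₋₁-n
  ∈nbrs⇒Edge leaf₃ y∈ rewrite nbrs-leaf {2 + m} (ℕ.n≤1+n _) with y∈
  ... | here refl = inj₂ edge-n₋₁-n₊₁

  Edge⇒∈nbrs : ∀ {x y} → Edge n (suc x) (suc y) → y ∈ nbrs x
  Edge⇒∈nbrs (inj₁ xy) = OrderedEdge⇒∈nbrs xy
  Edge⇒∈nbrs (inj₂ yx) = OrderedEdge⇒∈nbrs⁻ yx

  nbrs-unique : ∀ {x} → Vertex x → Unique (nbrs x)
  nbrs-unique leaf₀ = [] ∷ []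
  nbrs-unique leaf₁ = [] ∷ []
  nbrs-unique (inner {zero} 0<m) rewrite nbrs-inner 0<m =
    ((λ ()) ∷ (λ ()) ∷ []) ∷ ((λ ()) ∷ []) ∷ [] ∷ []
  nbrs-unique (inner {suc q} 1+q<m) rewrite nbrs-inner 1+q<m = ((λ ()) ∷ []) ∷ [] ∷ []
  nbrs-unique end rewrite nbrs-end = unique m
    where
    unique : ∀ p → Unique (left p ++ (3 + p ∷ 4 + p ∷ []))
    unique zero    = ((λ ()) ∷ (λ ()) ∷ (λ ()) ∷ []) ∷ ((λ ()) ∷ (λ ()) ∷ []) ∷ ((λ ()) ∷ []) ∷ [] ∷ []
    unique (suc q) = ((λ ()) ∷ (λ ()) ∷ []) ∷ ((λ ()) ∷ []) ∷ [] ∷ []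
  nbrs-unique leaf₂ rewrite nbrs-leaf {suc m} ℕ.≤-refl = [] ∷ []
  nbrs-unique leaf₃ rewrite nbrs-leaf {2 + m} (ℕ.n≤1+n _) = [] ∷ []

  OrderedEdge⇒≤ : ∀ {a b} → OrderedEdge n a b → a ≤ suc n × b ≤ suc n
  OrderedEdge⇒≤ edge-1-3     = s≤s z≤n , s≤s (s≤s (s≤s z≤n))
  OrderedEdge⇒≤ edge-2-3     = s≤s (s≤s z≤n) , s≤s (s≤s (s≤s z≤n))
  OrderedEdge⇒≤ edge-n₋₁-n   = ℕ.m≤n⇒m≤1+n (ℕ.n≤1+n _) , ℕ.n≤1+n n
  OrderedEdge⇒≤ edge-n₋₁-n₊₁ = ℕ.m≤n⇒m≤1+n (ℕ.n≤1+n _) , ℕ.≤-refl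
  OrderedEdge⇒≤ (edge-path a _ a≤2+m) =
    ℕ.m≤n⇒m≤1+n (ℕ.m≤n⇒m≤1+n (ℕ.m≤n⇒m≤1+n a≤2+m)) , s≤s (ℕ.m≤n⇒m≤1+n (ℕ.m≤n⇒m≤1+n a≤2+m))

  ∈nbrs⇒< : ∀ {x y} → Vertex x → y ∈ nbrs x → y ℕ.< suc n
  ∈nbrs⇒< v y∈ with ∈nbrs⇒Edge v y∈
  ... | inj₁ xy = proj₂ (OrderedEdge⇒≤ xy)
  ... | inj₂ yx = proj₁ (OrderedEdge⇒≤ yx)

  indicator-edge≡occurrences : ∀ {x} y → Vertex x → indicator (edge n (suc x) (suc y)) ≡ occurrences y (nbrs x)
  indicator-edge≡occurrences {x} y v with edge n (suc x) (suc y) in e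
  ... | true  = sym (occurrences-∈ (nbrs x) (nbrs-unique v) (Edge⇒∈nbrs (edge⇒Edge n (suc x) (suc y) (subst T (sym e) _))))
  ... | false = sym (occurrences-∉ (nbrs x) (λ y∈ → subst T e (Edge⇒edge (∈nbrs⇒Edge v y∈))))

  sumℕ-adjD̃ : ∀ i (g : ℕ → ℕ) → sumℕ (λ j → adjD̃ n i j * g (toℕ j)) ≡ sum (map g (nbrs (toℕ i)))
  sumℕ-adjD̃ i g =
    trans (sumℕ-cong {suc n} (λ j → cong (_* g (toℕ j)) (indicator-edge≡occurrences (toℕ j) v)))
          (sumℕ-occurrences {suc n} (nbrs (toℕ i)) g (All.tabulate (∈nbrs⇒< v)))
    where v = vertex (ℕ.≤-pred (Fin.toℕ<n i))

  walks : ℕ → ℕ → ℕ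
  walks zero    x = 1
  walks (suc k) x = sum (map (walks k) (nbrs x))

  powOnes≡walks : ∀ k i → powOnes (adjD̃ n) k i ≡ walks k (toℕ i)
  powOnes≡walks zero    i = refl
  powOnes≡walks (suc k) i =
    trans (sumℕ-cong {suc n} (λ j → cong (adjD̃ n i j *_) (powOnes≡walks k j))) (sumℕ-adjD̃ i (walks k))

  Mirrored : (ℕ → ℕ) → Set
  Mirrored g = ∀ x y → x + y ≡ n → g x ≡ g y

  module _ (g : ℕ → ℕ) (mirrored : Mirrored g) where

    sum-nbrs-leaf₀ : sum (map g (nbrs 0)) ≡ sum (map g (nbrs (4 + m)))
    sum-nbrs-leaf₀ rewrite nbrs-leaf {2 + m} (ℕ.n≤1+n _) = cong (_+ 0) (mirrored 2 (2 + m) refl)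

    sum-nbrs-leaf₁ : sum (map g (nbrs 1)) ≡ sum (map g (nbrs (3 + m)))
    sum-nbrs-leaf₁ rewrite nbrs-leaf {suc m} ℕ.≤-refl = cong (_+ 0) (mirrored 2 (2 + m) refl)

    sum-nbrs-ends : ∀ q → q ≡ m → sum (map g (nbrs 2)) ≡ sum (map g (nbrs (2 + q)))
    sum-nbrs-ends zero    refl = refl
    sum-nbrs-ends (suc q) refl
      rewrite nbrs-inner {0} (s≤s z≤n) | nbrs-end
            | mirrored 0 (4 + m) refl | mirrored 1 (3 + m) refl | mirrored 3 (2 + q) refl =
      solve 3 (λ a b c → a :+ (b :+ (c :+ con 0)) := c :+ (b :+ (a :+ con 0)))
        refl (g (4 + m)) (g (3 + m)) (g (2 + q))

    sum-nbrs-path : ∀ p q → p + q ≡ m → sum (map g (nbrs (2 + p))) ≡ sum (map g (nbrs (2 + q)))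
    sum-nbrs-path zero    q       p+q≡m = sum-nbrs-ends q p+q≡m
    sum-nbrs-path (suc p) zero    p+q≡m = sym (sum-nbrs-ends (suc p) (trans (sym (ℕ.+-identityʳ (suc p))) p+q≡m))
    sum-nbrs-path (suc p) (suc q) refl
      rewrite nbrs-inner {suc p} (s≤s (ℕ.m<m+n p (s≤s z≤n)))
            | nbrs-inner {suc q} (s≤s (ℕ.m≤n+m (suc q) p))
            | mirrored (2 + p) (4 + q) (solve 2 (λ p q → con 2 :+ p :+ (con 4 :+ q)
                                                        := con 5 :+ (p :+ (con 1 :+ q))) refl p q)
            | mirrored (4 + p) (2 + q) (solve 2 (λ p q → con 4 :+ p :+ (con 2 :+ q)
                                                        := con 5 :+ (p :+ (con 1 :+ q))) refl p q) =
      solve 2 (λ a b → a :+ (b :+ con 0) := b :+ (a :+ con 0)) refl (g (4 + q)) (g (2 + q))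

    sum-nbrs-mirrored : Mirrored (λ x → sum (map g (nbrs x)))
    sum-nbrs-mirrored zero          _ refl = sum-nbrs-leaf₀
    sum-nbrs-mirrored (suc zero)    _ refl = sum-nbrs-leaf₁
    sum-nbrs-mirrored (suc (suc p)) zero e
      with refl ← ℕ.suc-injective (ℕ.suc-injective (trans (cong (2 +_) (sym (ℕ.+-identityʳ p))) e)) =
      sym sum-nbrs-leaf₀
    sum-nbrs-mirrored (suc (suc p)) (suc zero) e
      with refl ← ℕ.suc-injective (ℕ.suc-injective (trans (cong (2 +_) (ℕ.+-comm 1 p)) e)) =
      sym sum-nbrs-leaf₁
    sum-nbrs-mirrored (suc (suc p)) (suc (suc q)) e =
      sum-nbrs-path p q (ℕ.+-cancelˡ-≡ 4 _ _
        (trans (solve 2 (λ p q → con 4 :+ (p :+ q) := con 2 :+ p :+ (con 2 :+ q)) refl p q) e))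

  walks-mirrored : ∀ k → Mirrored (walks k)
  walks-mirrored zero    _ _ _ = refl
  walks-mirrored (suc k) = sum-nbrs-mirrored (walks k) (walks-mirrored k)

  walks-leaf₁ : ∀ k → walks k 1 ≡ walks k 0
  walks-leaf₁ zero    = refl
  walks-leaf₁ (suc k) = refl

  weight : ℕ → ℕ
  weight zero          = 1
  weight (suc zero)    = 1
  weight (suc (suc p)) = if p ≤ᵇ m then 2 else 1

  weight≤2 : ∀ x → weight x ≤ 2
  weight≤2 zero          = s≤s z≤n
  weight≤2 (suc zero)    = s≤s z≤n
  weight≤2 (suc (suc p)) with p ≤ᵇ m
  ... | true  = ℕ.≤-refl
  ... | false = s≤s z≤n

  weight-path : ∀ {p} → p ≤ m → weight (2 + p) ≡ 2
  weight-path p≤m rewrite ≤ᵇ-true p≤m = refl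

  weight-leaf : ∀ {p} → m ℕ.< p → weight (2 + p) ≡ 1
  weight-leaf m<p rewrite ≤ᵇ-false (ℕ.<⇒≱ m<p) = refl

  sum-weight-left : ∀ {p} → p ≤ m → sum (map weight (left p)) ≡ 2
  sum-weight-left {zero}  _     = refl
  sum-weight-left {suc p} 1+p≤m rewrite weight-path (ℕ.<⇒≤ 1+p≤m) = refl

  weight-eigen : ∀ {x} → Vertex x → sum (map weight (nbrs x)) ≡ 2 * weight x
  weight-eigen leaf₀ = refl
  weight-eigen leaf₁ = refl
  weight-eigen (inner {p} p<m)
    rewrite nbrs-inner p<m | sum-map-++ weight (left p) (3 + p ∷ [])
          | sum-weight-left (ℕ.<⇒≤ p<m) | weight-path p<m | weight-path (ℕ.<⇒≤ p<m) = refl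
  weight-eigen end
    rewrite nbrs-end | sum-map-++ weight (left m) (3 + m ∷ 4 + m ∷ [])
          | sum-weight-left ℕ.≤-refl | weight-path (ℕ.≤-refl {m})
          | weight-leaf {suc m} ℕ.≤-refl | weight-leaf {2 + m} (ℕ.n≤1+n _) = refl
  weight-eigen leaf₂ rewrite nbrs-leaf {suc m} ℕ.≤-refl | weight-path (ℕ.≤-refl {m}) | weight-leaf {suc m} ℕ.≤-refl = refl
  weight-eigen leaf₃ rewrite nbrs-leaf {2 + m} (ℕ.n≤1+n _) | weight-path (ℕ.≤-refl {m}) | weight-leaf {2 + m} (ℕ.n≤1+n _) = refl

  vertex-∈nbrs : ∀ {x y} → Vertex x → y ∈ nbrs x → Vertex y
  vertex-∈nbrs v y∈ = vertex (ℕ.≤-pred (∈nbrs⇒< v y∈))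

  -- The all-ones vector dominates weight / 2, so Aᵏ 1 dominates Aᵏ weight / 2 = 2ᵏ weight / 2.
  walks-≥-weight : ∀ k {x} → Vertex x → 2 ^ k * weight x ≤ 2 * walks k x
  walks-≥-weight zero    {x} _ = ℕ.≤-trans (ℕ.≤-reflexive (ℕ.*-identityˡ (weight x))) (weight≤2 x)
  walks-≥-weight (suc k) {x} v = begin
    2 ^ suc k * weight x                         ≡⟨ solve 2 (λ a w → (con 2 :* a) :* w := a :* (con 2 :* w)) refl (2 ^ k) (weight x) ⟩
    2 ^ k * (2 * weight x)                       ≡⟨ cong (2 ^ k *_) (weight-eigen v) ⟨
    2 ^ k * sum (map weight (nbrs x))            ≡⟨ *-distribˡ-sum-map (2 ^ k) weight (nbrs x) ⟩
    sum (map (λ y → 2 ^ k * weight y) (nbrs x))  ≤⟨ sum-map-mono (nbrs x) (λ y∈ → walks-≥-weight k (vertex-∈nbrs v y∈)) ⟩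
    sum (map (λ y → 2 * walks k y) (nbrs x))     ≡⟨ *-distribˡ-sum-map 2 (walks k) (nbrs x) ⟨
    2 * walks (suc k) x                          ∎
    where open ℕ.≤-Reasoning

  walks-path-≥ : ∀ k {p} → p ≤ m → 2 ^ k ≤ walks k (2 + p)
  walks-path-≥ k {p} p≤m = ℕ.*-cancelˡ-≤ 2 (begin
    2 * 2 ^ k             ≡⟨ ℕ.*-comm 2 (2 ^ k) ⟩
    2 ^ k * 2             ≡⟨ cong (2 ^ k *_) (weight-path p≤m) ⟨
    2 ^ k * weight (2 + p) ≤⟨ walks-≥-weight k (vertex (s≤s (s≤s (ℕ.m≤n⇒m≤1+n (ℕ.m≤n⇒m≤1+n p≤m))))) ⟩
    2 * walks k (2 + p)   ∎)
    where open ℕ.≤-Reasoning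

  walks-inner : ∀ k {q} → suc q ℕ.< m → walks (suc k) (3 + q) ≡ walks k (2 + q) + walks k (4 + q)
  walks-inner k {q} 1+q<m rewrite nbrs-inner 1+q<m = cong (walks k (2 + q) +_) (ℕ.+-identityʳ _)

  walks-path-≡ : ∀ k p → k ≤ p → k + p ≤ m → walks k (2 + p) ≡ 2 ^ k
  walks-path-≡ zero    p       _         _        = refl
  walks-path-≡ (suc k) (suc p) (s≤s k≤p) 1+k+1+p≤m = begin
    walks (suc k) (3 + p)            ≡⟨ walks-inner k (ℕ.≤-trans (s≤s (s≤s (ℕ.m≤n+m p k))) 2+k+p≤m) ⟩
    walks k (2 + p) + walks k (4 + p) ≡⟨ cong₂ _+_ (walks-path-≡ k p k≤p k+p≤m)
                                                   (walks-path-≡ k (2 + p) (ℕ.≤-trans k≤p (ℕ.m≤n+m p 2)) k+2+p≤m) ⟩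
    2 ^ k + 2 ^ k                     ≡⟨ cong (2 ^ k +_) (ℕ.+-identityʳ (2 ^ k)) ⟨
    2 ^ suc k                         ∎
    where
    open ≡-Reasoning
    k+2+p≤m : k + (2 + p) ≤ m
    k+2+p≤m = subst (_≤ m) (sym (ℕ.+-suc k (suc p))) 1+k+1+p≤m
    2+k+p≤m : 2 + (k + p) ≤ m
    2+k+p≤m = subst (_≤ m) (cong suc (ℕ.+-suc k p)) 1+k+1+p≤m
    k+p≤m : k + p ≤ m
    k+p≤m = ℕ.≤-trans (ℕ.n≤1+n _) (ℕ.≤-trans (ℕ.n≤1+n _) 2+k+p≤m)

  walks-path-> : ∀ p → p + p ≤ m → 2 ^ suc p ℕ.< walks (suc p) (2 + p)
  walks-path-> zero _ with vertex {2} (s≤s (s≤s z≤n))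
  ... | inner 0<m = subst (2 ℕ.<_) (sym (cong (λ L → sum (map (walks 0) L)) (nbrs-inner 0<m))) ℕ.≤-refl
  ... | end       = subst (2 ℕ.<_) (sym (cong (λ L → sum (map (walks 0) L)) nbrs-end)) (ℕ.n≤1+n _)
  walks-path-> (suc p) 1+p+1+p≤m = begin-strict
    2 ^ suc (suc p)                         ≡⟨ cong (2 ^ suc p +_) (ℕ.+-identityʳ (2 ^ suc p)) ⟩
    2 ^ suc p + 2 ^ suc p                   <⟨ ℕ.+-mono-<-≤ (walks-path-> p p+p≤m) (walks-path-≥ (suc p) 2+p≤m) ⟩
    walks (suc p) (2 + p) + walks (suc p) (4 + p) ≡⟨ walks-inner (suc p) 2+p≤m ⟨
    walks (suc (suc p)) (3 + p)             ∎
    where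
    open ℕ.≤-Reasoning
    2+p≤m : 2 + p ≤ m
    2+p≤m = ℕ.≤-trans (s≤s (ℕ.m≤n+m (suc p) p)) 1+p+1+p≤m
    p+p≤m : p + p ≤ m
    p+p≤m = ℕ.≤-trans (ℕ.+-monoʳ-≤ p (ℕ.n≤1+n p)) (ℕ.≤-trans (ℕ.n≤1+n _) 1+p+1+p≤m)

  representative : Fin (2 + ⌊ m /2⌋) → ℕ
  representative zero    = 0
  representative (suc t) = 2 + toℕ t

  Orbit : ℕ → Set
  Orbit x = ∃ λ t → ∀ k → walks k x ≡ walks k (representative t)

  orbit-lowerHalf : ∀ {p} → p ≤ ⌊ m /2⌋ → Orbit (2 + p)
  orbit-lowerHalf p≤⌊m/2⌋ =
    suc (Fin.fromℕ< (s≤s p≤⌊m/2⌋)) , λ k → cong (λ t → walks k (2 + t)) (sym (Fin.toℕ-fromℕ< (s≤s p≤⌊m/2⌋)))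

  orbit-mirror : ∀ {p q} → p + q ≡ m → Orbit (2 + q) → Orbit (2 + p)
  orbit-mirror {p} {q} p+q≡m (t , same-walks) = t , λ k → trans (walks-mirrored k (2 + p) (2 + q) mirror) (same-walks k)
    where
    mirror : 2 + p + (2 + q) ≡ n
    mirror = trans (solve 2 (λ p q → con 2 :+ p :+ (con 2 :+ q) := con 4 :+ (p :+ q)) refl p q) (cong (4 +_) p+q≡m)

  orbit-path : ∀ {p} → p ≤ m → Orbit (2 + p)
  orbit-path {p} p≤m with p ℕ.≤? ⌊ m /2⌋
  ... | yes p≤⌊m/2⌋ = orbit-lowerHalf p≤⌊m/2⌋
  ... | no  p≰⌊m/2⌋ = orbit-mirror p+q≡m (orbit-lowerHalf (complement≤⌊n/2⌋ p+q≡m (ℕ.≰⇒> p≰⌊m/2⌋)))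
    where
    p+q≡m : p + (m ∸ p) ≡ m
    p+q≡m = ℕ.m+[n∸m]≡n p≤m

  orbit : ∀ {x} → Vertex x → Orbit x
  orbit leaf₀           = zero , λ _ → refl
  orbit leaf₁           = zero , walks-leaf₁
  orbit (inner p<m)     = orbit-path (ℕ.<⇒≤ p<m)
  orbit end             = orbit-path ℕ.≤-refl
  orbit leaf₂           = zero , λ k → trans (walks-mirrored k (3 + m) 1 (ℕ.+-comm (3 + m) 1)) (walks-leaf₁ k)
  orbit leaf₃           = zero , λ k → walks-mirrored k (4 + m) 0 (ℕ.+-identityʳ (4 + m))

  vertexOf : (i : Fin (suc n)) → Vertex (toℕ i)
  vertexOf i = vertex (ℕ.≤-pred (Fin.toℕ<n i))

  weighted-walks : ∀ k → sumℕ {suc n} (λ i → weight (toℕ i) * walks k (toℕ i)) ≡ 2 ^ k * sumℕ {suc n} (weight ∘ toℕ)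
  weighted-walks k = begin
    sumℕ {suc n} (λ i → weight (toℕ i) * walks k (toℕ i))
      ≡⟨ sumℕ-cong {suc n} (λ i → cong (weight (toℕ i) *_) (powOnes≡walks k i)) ⟨
    sumℕ {suc n} (λ i → weight (toℕ i) * powOnes (adjD̃ n) k i)
      ≡⟨ powOnes-eigenweight (adjD̃ n) (weight ∘ toℕ) 2 (adjD̃-symmetric n) adjD̃-weight k ⟩
    2 ^ k * sumℕ {suc n} (weight ∘ toℕ) ∎
    where
    open ≡-Reasoning
    adjD̃-weight : ∀ i → sumℕ (λ j → adjD̃ n i j * weight (toℕ j)) ≡ 2 * weight (toℕ i)
    adjD̃-weight i = trans (sumℕ-adjD̃ i weight) (weight-eigen (vertexOf i))

module Rank (m : ℕ) where

  open D̃ m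
  open import Data.Nat using (_+_)
  open import Data.Rational using (_*_; _-_)

  r : ℕ
  r = ⌊ n /2⌋

  W : Fin (suc n) → Fin (suc n) → ℚ
  W i k = ℕ→ℚ (walkMatrix (adjD̃ n) i k)

  W≡walks : ∀ i k → W i k ≡ ℕ→ℚ (walks (toℕ k) (toℕ i))
  W≡walks i k = cong ℕ→ℚ (powOnes≡walks (toℕ k) i)

  representative< : ∀ t → representative t ℕ.< suc n
  representative< zero    = s≤s z≤n
  representative< (suc t) =
    s≤s (s≤s (s≤s (ℕ.≤-trans (ℕ.≤-pred (Fin.toℕ<n t)) (ℕ.≤-trans (ℕ.⌊n/2⌋≤n m) (ℕ.m≤n⇒m≤1+n (ℕ.n≤1+n m))))))

  ρ : Fin r → Fin (suc n)
  ρ t = Fin.fromℕ< (representative< t)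

  W-orbit : ∀ i t → (∀ k → walks k (toℕ i) ≡ walks k (representative t)) → ∀ k → W i k ≡ W (ρ t) k
  W-orbit i t same-walks k = cong ℕ→ℚ (begin
    powOnes (adjD̃ n) (toℕ k) i        ≡⟨ powOnes≡walks (toℕ k) i ⟩
    walks (toℕ k) (toℕ i)             ≡⟨ same-walks (toℕ k) ⟩
    walks (toℕ k) (representative t)  ≡⟨ cong (walks (toℕ k)) (Fin.toℕ-fromℕ< (representative< t)) ⟨
    walks (toℕ k) (toℕ (ρ t))         ≡⟨ powOnes≡walks (toℕ k) (ρ t) ⟨
    powOnes (adjD̃ n) (toℕ k) (ρ t)    ∎)
    where open ≡-Reasoning

  rows-represented : ∀ i → ∃ λ t → ∀ k → W i k ≡ W (ρ t) k
  rows-represented i = proj₁ o , W-orbit i (proj₁ o) (proj₂ o)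
    where
    o : Orbit (toℕ i)
    o = orbit (vertexOf i)

  r≤1+n : r ≤ suc n
  r≤1+n = ℕ.≤-trans (ℕ.⌊n/2⌋≤n n) (ℕ.n≤1+n n)

  first : Fin r → Fin (suc n)
  first j = Fin.inject≤ j r≤1+n

  W-first : ∀ i j → W i (first j) ≡ ℕ→ℚ (walks (toℕ j) (toℕ i))
  W-first i j = trans (W≡walks i (first j)) (cong (λ k → ℕ→ℚ (walks k (toℕ i))) (Fin.toℕ-inject≤ j r≤1+n))

  -- Entry (t, j) is a linear functional of column j: wᵀ Aʲ e / wᵀ e = 2ʲ for t = 0, and for
  -- t = p + 1 the entry of Aʲ e at the p-th path vertex minus 2ʲ.
  functional : Fin r → Fin r → ℚ
  functional zero    j = ℕ→ℚ (2 ^ toℕ j)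
  functional (suc t) j = ℕ→ℚ (walks (toℕ j) (2 + toℕ t)) - ℕ→ℚ (2 ^ toℕ j)

  functional-triangular : ∀ {t j} → j Fin.< t → functional t j ≡ 0ℚ
  functional-triangular {suc t} {j} (s≤s j≤t) =
    trans (cong (λ w → ℕ→ℚ w - ℕ→ℚ (2 ^ toℕ j)) (walks-path-≡ (toℕ j) (toℕ t) j≤t j+t≤m))
          (ℚ.+-inverseʳ (ℕ→ℚ (2 ^ toℕ j)))
    where
    t≤⌊m/2⌋ : toℕ t ≤ ⌊ m /2⌋
    t≤⌊m/2⌋ = ℕ.≤-pred (Fin.toℕ<n t)
    j+t≤m : toℕ j + toℕ t ≤ m
    j+t≤m = ≤⌊n/2⌋⇒+≤n (ℕ.≤-trans j≤t t≤⌊m/2⌋) t≤⌊m/2⌋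

  functional-diagonal : ∀ t → functional t t ≢ 0ℚ
  functional-diagonal zero    = ℕ→ℚ-suc≢0 0
  functional-diagonal (suc t) = ℕ→ℚ-ℕ→ℚ≢0 (ℕ.>⇒≢ (walks-path-> (toℕ t) (≤⌊n/2⌋⇒+≤n t≤⌊m/2⌋ t≤⌊m/2⌋)))
    where
    t≤⌊m/2⌋ : toℕ t ≤ ⌊ m /2⌋
    t≤⌊m/2⌋ = ℕ.≤-pred (Fin.toℕ<n t)

  module _ (c : Fin r → ℚ) (relation : ∀ i → sumℚ (λ j → c j * W i (first j)) ≡ 0ℚ) where

    walks-relation : ∀ x → x ℕ.< suc n → sumℚ (λ j → c j * ℕ→ℚ (walks (toℕ j) x)) ≡ 0ℚ
    walks-relation x x<1+n = begin
      sumℚ (λ j → c j * ℕ→ℚ (walks (toℕ j) x))       ≡⟨ sumℚ-cong (λ j → cong (λ y → c j * ℕ→ℚ (walks (toℕ j) y)) (Fin.toℕ-fromℕ< x<1+n)) ⟨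
      sumℚ (λ j → c j * ℕ→ℚ (walks (toℕ j) (toℕ i))) ≡⟨ sumℚ-cong (λ j → cong (c j *_) (W-first i j)) ⟨
      sumℚ (λ j → c j * W i (first j))               ≡⟨ relation i ⟩
      0ℚ                                             ∎
      where
      open ≡-Reasoning
      i : Fin (suc n)
      i = Fin.fromℕ< x<1+n

    powers-relation : sumℚ (λ j → c j * ℕ→ℚ (2 ^ toℕ j)) ≡ 0ℚ
    powers-relation = *-cancelʳ-≡0 _ (ℕ→ℚ D) weighted-relation (ℕ→ℚ-suc≢0 (sumℕ {n} (weight ∘ suc ∘ toℕ)))
      where
      open ≡-Reasoning
      D : ℕ
      D = sumℕ {suc n} (weight ∘ toℕ)
      w : Fin (suc n) → ℚ
      w i = ℕ→ℚ (weight (toℕ i))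
      v : Fin r → Fin (suc n) → ℚ
      v j i = ℕ→ℚ (walks (toℕ j) (toℕ i))
      weighted : ∀ j → sumℚ (λ i → w i * v j i) ≡ ℕ→ℚ (2 ^ toℕ j) * ℕ→ℚ D
      weighted j = begin
        sumℚ (λ i → w i * v j i)                                         ≡⟨ sumℚ-cong {suc n} (λ i → ℕ→ℚ-* (weight (toℕ i)) (walks (toℕ j) (toℕ i))) ⟨
        sumℚ {suc n} (ℕ→ℚ ∘ λ i → weight (toℕ i) ℕ.* walks (toℕ j) (toℕ i)) ≡⟨ sumℚ-ℕ→ℚ {suc n} (λ i → weight (toℕ i) ℕ.* walks (toℕ j) (toℕ i)) ⟩
        ℕ→ℚ (sumℕ {suc n} (λ i → weight (toℕ i) ℕ.* walks (toℕ j) (toℕ i)))      ≡⟨ cong ℕ→ℚ (weighted-walks (toℕ j)) ⟩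
        ℕ→ℚ (2 ^ toℕ j ℕ.* D)                                           ≡⟨ ℕ→ℚ-* (2 ^ toℕ j) D ⟩
        ℕ→ℚ (2 ^ toℕ j) * ℕ→ℚ D                                          ∎
      weighted-relation : sumℚ (λ j → c j * ℕ→ℚ (2 ^ toℕ j)) * ℕ→ℚ D ≡ 0ℚ
      weighted-relation = begin
        sumℚ (λ j → c j * ℕ→ℚ (2 ^ toℕ j)) * ℕ→ℚ D    ≡⟨ *-distribʳ-sumℚ (ℕ→ℚ D) (λ j → c j * ℕ→ℚ (2 ^ toℕ j)) ⟩
        sumℚ (λ j → c j * ℕ→ℚ (2 ^ toℕ j) * ℕ→ℚ D)    ≡⟨ sumℚ-cong (λ j → trans (ℚ.*-assoc (c j) (ℕ→ℚ (2 ^ toℕ j)) (ℕ→ℚ D)) (cong (c j *_) (sym (weighted j)))) ⟩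
        sumℚ (λ j → c j * sumℚ (λ i → w i * v j i))   ≡⟨ relation⇒functional-relation v c w (λ i → walks-relation (toℕ i) (Fin.toℕ<n i)) ⟩
        0ℚ                                            ∎

    functional-relation : ∀ t → sumℚ (λ j → c j * functional t j) ≡ 0ℚ
    functional-relation zero    = powers-relation
    functional-relation (suc t) = begin
      sumℚ (λ j → c j * functional (suc t) j)
        ≡⟨ sumℚ-*-distribˡ-- c (λ j → ℕ→ℚ (walks (toℕ j) (2 + toℕ t))) (λ j → ℕ→ℚ (2 ^ toℕ j)) ⟩
      sumℚ (λ j → c j * ℕ→ℚ (walks (toℕ j) (2 + toℕ t))) - sumℚ (λ j → c j * ℕ→ℚ (2 ^ toℕ j))
        ≡⟨ cong₂ _-_ (walks-relation (2 + toℕ t) (representative< (suc t))) powers-relation ⟩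
      0ℚ - 0ℚ
        ≡⟨ ℚ.+-inverseʳ 0ℚ ⟩
      0ℚ ∎
      where open ≡-Reasoning

  first-independent : LinIndep (λ j i → W i (first j))
  first-independent c relation =
    triangular⇒relation-trivial functional functional-triangular functional-diagonal c (functional-relation c relation)

  rank : HasRank W r
  rank = (first , (λ {i} {j} → Fin.inject≤-injective r≤1+n r≤1+n i j) , first-independent)
       , λ s _ → rowsRepresented⇒¬LinIndep W ρ rows-represented s

corollary2p9 : (n : ℕ) → 4 ≤ n →
    HasRank (λ i k → ℕ→ℚ (walkMatrix (adjD̃ n) i k)) ⌊ n /2⌋
corollary2p9 _ (s≤s (s≤s (s≤s (s≤s (z≤n {m}))))) = Rank.rank m
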